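{- Let $p$ be a prime with $p\equiv 1\pmod 4$ such that $p+1$ has at least one divisor $d$ with $d\equiv 3\pmod 4$. Then there exist positive integers $x,y,z$ with $$\frac{4}{p}=\frac{1}{x}+\frac{1}{y}+\frac{1}{z}.$$ -}

-- If d = 4k + 3 divides p + 1, say p + 1 = m d, then
--   1/(p(k+1)) + 1/(m(k+1)) + 1/(mp(k+1)) = (m + p + 1)/(mp(k+1)) = m(d + 1)/(mp(k+1)) = 4/p.
module Submission where

open import Data.Integer as ℤ using (+_)
open import Data.Integer.Properties using (pos-*)
open import Data.Nat as ℕ using (ℕ; zero; suc; pred; NonZero; _*_; _%_)
open import Data.Nat.DivMod using (m≡m%n+[m/n]*n)
open import Data.Nat.Divisibility using (_∣_; divides)
open import Data.Nat.Primality using (Prime; prime⇒nonZero)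
open import Data.Nat.Tactic.RingSolver using (solve-∀)
open import Data.Product using (_×_; _,_; ∃-syntax)
open import Data.Rational using (_/_; _+_; toℚᵘ; fromℚᵘ)
open import Data.Rational.Properties using (toℚᵘ-injective; toℚᵘ-fromℚᵘ; toℚᵘ-homo-+; fromℚᵘ-cong)
open import Data.Rational.Unnormalised as ℚᵘ using (ℚᵘ; mkℚᵘ; *≡*)
import Data.Rational.Unnormalised.Properties as ℚᵘ
open import Relation.Binary.PropositionalEquality using (_≡_; cong; trans; module ≡-Reasoning)

fromℚᵘ-homo-+ : ∀ p q → fromℚᵘ (p ℚᵘ.+ q) ≡ fromℚᵘ p + fromℚᵘ q
fromℚᵘ-homo-+ p q = toℚᵘ-injective (begin
  toℚᵘ (fromℚᵘ (p ℚᵘ.+ q))            ≈⟨ toℚᵘ-fromℚᵘ (p ℚᵘ.+ q) ⟩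
  p ℚᵘ.+ q                            ≈⟨ ℚᵘ.+-cong (toℚᵘ-fromℚᵘ p) (toℚᵘ-fromℚᵘ q) ⟨
  toℚᵘ (fromℚᵘ p) ℚᵘ.+ toℚᵘ (fromℚᵘ q) ≈⟨ toℚᵘ-homo-+ (fromℚᵘ p) (fromℚᵘ q) ⟨
  toℚᵘ (fromℚᵘ p + fromℚᵘ q)          ∎)
  where open ℚᵘ.≃-Reasoning

k/n≡1/x+1/y+1/z : ∀ k n x y z →
  .{{_ : NonZero n}} .{{_ : NonZero x}} .{{_ : NonZero y}} .{{_ : NonZero z}} →
  k * (x * y * z) ≡ (y * z ℕ.+ x * z ℕ.+ x * y) * n →
  + k / n ≡ + 1 / x + + 1 / y + + 1 / z
k/n≡1/x+1/y+1/z k n@(suc n-1) x@(suc x-1) y@(suc y-1) z@(suc z-1) eq = begin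
  + k / n                               ≡⟨ fromℚᵘ-cong {mkℚᵘ (+ k) n-1} {1/x ℚᵘ.+ 1/y ℚᵘ.+ 1/z} (*≡* cross-multiplied) ⟩
  fromℚᵘ (1/x ℚᵘ.+ 1/y ℚᵘ.+ 1/z)         ≡⟨ fromℚᵘ-homo-+ (1/x ℚᵘ.+ 1/y) 1/z ⟩
  fromℚᵘ (1/x ℚᵘ.+ 1/y) + fromℚᵘ 1/z     ≡⟨ cong (_+ fromℚᵘ 1/z) (fromℚᵘ-homo-+ 1/x 1/y) ⟩
  + 1 / x + + 1 / y + + 1 / z            ∎
  where
  open ≡-Reasoning
  1/x 1/y 1/z : ℚᵘ
  1/x = mkℚᵘ (+ 1) x-1
  1/y = mkℚᵘ (+ 1) y-1
  1/z = mkℚᵘ (+ 1) z-1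
  -- the numerator exactly as ℚᵘ._+_ computes it, unit factors included
  sum-numerator : ∀ a b c → b * c ℕ.+ a * c ℕ.+ a * b ≡ (1 * b ℕ.+ 1 * a) * c ℕ.+ 1 * (a * b)
  sum-numerator = solve-∀
  cross-multiplied : + k ℤ.* + (x * y * z) ≡ + ((1 * y ℕ.+ 1 * x) * z ℕ.+ 1 * (x * y)) ℤ.* + n
  cross-multiplied = begin
    + k ℤ.* + (x * y * z)                                  ≡⟨ pos-* k (x * y * z) ⟨
    + (k * (x * y * z))                                    ≡⟨ cong +_ eq ⟩
    + ((y * z ℕ.+ x * z ℕ.+ x * y) * n)                     ≡⟨ cong (λ m → + (m * n)) (sum-numerator x y z) ⟩
    + (((1 * y ℕ.+ 1 * x) * z ℕ.+ 1 * (x * y)) * n)         ≡⟨ pos-* ((1 * y ℕ.+ 1 * x) * z ℕ.+ 1 * (x * y)) n ⟩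
    + ((1 * y ℕ.+ 1 * x) * z ℕ.+ 1 * (x * y)) ℤ.* + n        ∎

ErdősStraus : (n : ℕ) .{{_ : NonZero n}} → Set
ErdősStraus n = ∃[ a ] ∃[ b ] ∃[ c ] + 4 / n ≡ + 1 / suc a + + 1 / suc b + + 1 / suc c

erdősStraus-identity : ∀ p m k → suc p ≡ m * (3 ℕ.+ k * 4) →
  4 * ((p * suc k) * (m * suc k) * (m * p * suc k))
    ≡ ((m * suc k) * (m * p * suc k) ℕ.+ (p * suc k) * (m * p * suc k) ℕ.+ (p * suc k) * (m * suc k)) * p
erdősStraus-identity p m k p+1≡md = begin
  4 * ((p * suc k) * (m * suc k) * (m * p * suc k))    ≡⟨ factor-out-m+md p m k ⟩
  m * (p * p) * (suc k * suc k) * (m ℕ.+ m * (3 ℕ.+ k * 4)) ≡⟨ cong (λ t → m * (p * p) * (suc k * suc k) * (m ℕ.+ t)) p+1≡md ⟨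
  m * (p * p) * (suc k * suc k) * (m ℕ.+ suc p)             ≡⟨ factor-out-m+p+1 p m k ⟩
  ((m * suc k) * (m * p * suc k) ℕ.+ (p * suc k) * (m * p * suc k) ℕ.+ (p * suc k) * (m * suc k)) * p ∎
  where
  open ≡-Reasoning
  factor-out-m+md : ∀ p m k → 4 * ((p * suc k) * (m * suc k) * (m * p * suc k))
                                ≡ m * (p * p) * (suc k * suc k) * (m ℕ.+ m * (3 ℕ.+ k * 4))
  factor-out-m+md = solve-∀
  factor-out-m+p+1 : ∀ p m k → m * (p * p) * (suc k * suc k) * (m ℕ.+ suc p)
                                 ≡ ((m * suc k) * (m * p * suc k) ℕ.+ (p * suc k) * (m * p * suc k) ℕ.+ (p * suc k) * (m * suc k)) * p
  factor-out-m+p+1 = solve-∀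

erdősStraus-of-divisor≡3mod4 : ∀ n → ∃[ d ] (d ∣ suc (suc n) × d % 4 ≡ 3) → ErdősStraus (suc n)
erdősStraus-of-divisor≡3mod4 n (d , divides zero () , _)
erdősStraus-of-divisor≡3mod4 n (d , divides m@(suc _) p+1≡md , d%4≡3) =
  pred x , pred y , pred z ,
  k/n≡1/x+1/y+1/z 4 p x y z (erdősStraus-identity p m k (trans p+1≡md (cong (m *_) d≡3+k*4)))
  where
  p k x y z : ℕ
  p = suc n
  k = d ℕ./ 4
  x = p * suc k
  y = m * suc k
  z = m * p * suc k
  d≡3+k*4 : d ≡ 3 ℕ.+ k * 4
  d≡3+k*4 = trans (m≡m%n+[m/n]*n d 4) (cong (ℕ._+ k * 4) d%4≡3)

corollary2p4 : (p : ℕ) → (pr : Prime p) → p % 4 ≡ 1 →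
    (∃[ d ] (d ∣ suc p × d % 4 ≡ 3)) →
    ∃[ a ] ∃[ b ] ∃[ c ]
      _/_ (+ 4) p {{prime⇒nonZero pr}}
        ≡ (+ 1) / suc a + (+ 1) / suc b + (+ 1) / suc c
corollary2p4 zero pr _ _ with () ← prime⇒nonZero pr
corollary2p4 (suc n) _ _ divisor = erdősStraus-of-divisor≡3mod4 n divisor
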